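{- The hypoplactic monoid $\mathrm{hypo}(\mathcal{C}_2)$ satisfies the identity $xyxyxy=xyyxxy$; that is, $uvuvuv\ \ddot{\sim}\ uvvuuv$ for all $u,v\in C_2^*$.
   Context: $|w|_a$ denotes the number of occurrences of the letter $a$ in the word $w$. Let $C_2=\{1<2<\bar2<\bar1\}$ and $C_2^*$ the free monoid over it; the symbols $3$ and $\bar3$ never occur. For $i\in\{1,2\}$, $w$ has an $i$-inversion if $w=w_1xw_2yw_3$ with $x\in\{i,\overline{i+1}\}$, $y\in\{i+1,\bar i\}$. Quasi-crystal structure on $C_2^*$: $\mathrm{wt}(w)=(|w|_1-|w|_{\bar1},|w|_2-|w|_{\bar2})$. For $i\in\{1,2\}$: if $w$ has an $i$-inversion then $\ddot{\varepsilon}_i(w)=\ddot{\varphi}_i(w)=+\infty$ and $\ddot{e}_i(w),\ddot{f}_i(w)$ are undefined; otherwise $\ddot{\varepsilon}_i(w)=|w|_{i+1}+|w|_{\bar i}$, $\ddot{\varphi}_i(w)=|w|_i+|w|_{\overline{i+1}}$; $\ddot{e}_i(w)$ is defined iff $\ddot{\varepsilon}_i(w)>0$ and is obtained by replacing the right-most letter of $w$ in $\{i+1,\bar i\}$ by its image ($\ddot{e}_1:2\mapsto1,\bar1\mapsto\bar2$; $\ddot{e}_2:\bar2\mapsto2$); $\ddot{f}_i(w)$ is defined iff $\ddot{\varphi}_i(w)>0$ and is obtained by replacing the left-most letter of $w$ in $\{i,\overline{i+1}\}$ by its image ($\ddot{f}_1:1\mapsto2,\bar2\mapsto\bar1$;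 $\ddot{f}_2:2\mapsto\bar2$). The connected component $C_2^*(w)$ is the set of words obtained from $w$ by finitely many (defined) applications of these operators. Hypoplactic congruence: $u\ddot{\sim}v$ iff there is a bijection $\psi:C_2^*(u)\to C_2^*(v)$ with $\psi(u)=v$ preserving $\mathrm{wt},\ddot{\varepsilon}_i,\ddot{\varphi}_i$ and such that $\ddot{e}_i(\psi(x))$ is defined iff $\ddot{e}_i(x)$ is (then $\psi(\ddot{e}_i(x))=\ddot{e}_i(\psi(x))$), likewise for $\ddot{f}_i$. It is a monoid congruence; $\mathrm{hypo}(\mathcal{C}_2)=C_2^*/\ddot{\sim}$. A monoid satisfies an identity $s=t$ in variables $X$ if every monoid homomorphism from $X^*$ identifies $s$ and $t$. -}

module Defs where

open import Data.Nat using (ℕ; zero; suc; _+_)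
open import Data.Integer using (ℤ; _-_; +_)
open import Data.Bool using (Bool; true; false; _∧_; _∨_; if_then_else_)
open import Data.List using (List; []; _∷_; _++_)
open import Data.Maybe using (Maybe; just; nothing; is-just)
import Data.Maybe as Maybe
open import Data.Product using (_×_; _,_; Σ; ∃; ∃-syntax)
open import Relation.Binary.PropositionalEquality using (_≡_)

-- The alphabet C₂ = {1 < 2 < 2̄ < 1̄}
data Letter : Set where
  l1 l2 l2̄ l1̄ : Letter

Word : Set
Word = List Letter

data Idx : Set where
  i1 i2 : Idx

count : Letter → Word → ℕ
count a [] = 0
count a (b ∷ w) with a | b
... | l1  | l1  = suc (count a w)
... | l2  | l2  = suc (count a w)
... | l2̄ | l2̄ = suc (count a w)
... | l1̄ | l1̄ = suc (count a w)
... | _   | _   = count a w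

-- image of a letter under ë_i; `nothing` iff the letter is not in {i+1, ī}
-- (the letters 3, 3̄ never occur, so for i = 2 this set is {2̄})
eL : Idx → Letter → Maybe Letter
eL i1 l2  = just l1
eL i1 l1̄ = just l2̄
eL i1 _   = nothing
eL i2 l2̄ = just l2
eL i2 _   = nothing

fL : Idx → Letter → Maybe Letter
fL i1 l1  = just l2
fL i1 l2̄ = just l1̄
fL i1 _   = nothing
fL i2 l2  = just l2̄
fL i2 _   = nothing

isY : Idx → Letter → Bool
isY i a = is-just (eL i a)

isX : Idx → Letter → Bool
isX i a = is-just (fL i a)

anyB : (Letter → Bool) → Word → Bool
anyB p [] = false
anyB p (a ∷ w) = p a ∨ anyB p w

hasInv : Idx → Word → Bool
hasInv i [] = false
hasInv i (a ∷ w) = (isX i a ∧ anyB (isY i) w) ∨ hasInv i w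

data ℕ∞ : Set where
  fin : ℕ → ℕ∞
  ∞   : ℕ∞

wt : Word → ℤ × ℤ
wt w = (+ count l1 w - + count l1̄ w , + count l2 w - + count l2̄ w)

ε̈ : Idx → Word → ℕ∞
ε̈ i w = if hasInv i w then ∞ else fin (εcount i)
  where
  εcount : Idx → ℕ
  εcount i1 = count l2 w + count l1̄ w
  εcount i2 = count l2̄ w          -- |w|_3 = 0

φ̈ : Idx → Word → ℕ∞
φ̈ i w = if hasInv i w then ∞ else fin (φcount i)
  where
  φcount : Idx → ℕ
  φcount i1 = count l1 w + count l2̄ w
  φcount i2 = count l2 w          -- |w|_{3̄} = 0

replaceRight : (Letter → Maybe Letter) → Word → Maybe Word
replaceRight g [] = nothing
replaceRight g (a ∷ w) with replaceRight g w
... | just w' = just (a ∷ w')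
... | nothing with g a
...   | just b  = just (b ∷ w)
...   | nothing = nothing

replaceLeft : (Letter → Maybe Letter) → Word → Maybe Word
replaceLeft g [] = nothing
replaceLeft g (a ∷ w) with g a
... | just b  = just (b ∷ w)
... | nothing = Maybe.map (a ∷_) (replaceLeft g w)

-- partial operators ë_i, f̈_i (nothing = undefined).
-- Undefined if w has an i-inversion; otherwise defined iff some letter of the
-- relevant set occurs, i.e. iff ε̈_i(w) > 0 (resp. φ̈_i(w) > 0).
ë : Idx → Word → Maybe Word
ë i w = if hasInv i w then nothing else replaceRight (eL i) w

f̈ : Idx → Word → Maybe Word
f̈ i w = if hasInv i w then nothing else replaceLeft (fL i) w

data Reach (u : Word) : Word → Set where
  here  : Reach u u
  stepE : ∀ {x y} i → Reach u x → ë i x ≡ just y → Reach u y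
  stepF : ∀ {x y} i → Reach u x → f̈ i x ≡ just y → Reach u y

record Hypo (u v : Word) : Set where
  field
    ψ        : Word → Word     -- only its restriction to C₂*(u) matters
    ψ-into   : ∀ {x} → Reach u x → Reach v (ψ x)
    ψ-inj    : ∀ {x y} → Reach u x → Reach u y → ψ x ≡ ψ y → x ≡ y
    ψ-onto   : ∀ {y} → Reach v y → ∃[ x ] (Reach u x × ψ x ≡ y)
    ψ-base   : ψ u ≡ v
    ψ-wt     : ∀ {x} → Reach u x → wt (ψ x) ≡ wt x
    ψ-ε      : ∀ {x} i → Reach u x → ε̈ i (ψ x) ≡ ε̈ i x
    ψ-φ      : ∀ {x} i → Reach u x → φ̈ i (ψ x) ≡ φ̈ i x
    ψ-ë      : ∀ {x} i → Reach u x → ë i (ψ x) ≡ Maybe.map ψ (ë i x)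
    ψ-f̈      : ∀ {x} i → Reach u x → f̈ i (ψ x) ≡ Maybe.map ψ (f̈ i x)

_∼̈_ : Word → Word → Set
u ∼̈ v = Hypo u v

-- Every letter of the middle factor uv of uv·uv·uv also occurs before and after
-- it, so uvuvuv turns into uvvuuv by transposing adjacent letters x y of words
-- A x y C in which x and y occur both in A and in C.  For such a transposition
-- the isomorphism of components keeps all letters but these two in place: it
-- swaps their bars, and also their 1-types when the word has a 1-inversion.
-- That this map commutes with the quasi-Kashiwara operators on a whole component
-- is verified on a finite abstraction, recording of A and of C only which
-- letters occur and whether there are 1- and 2-inversions; an explicit set of
-- such configurations is checked by evaluation to contain the starting ones, to
-- be closed under the operators, and to make the map locally compatible.
module Submission where

open import Defs
open import Data.Bool using (Bool; true; false; T; not; _∧_; _∨_; if_then_else_)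
open import Data.Bool.Properties using (T-∧; T-∨; ∨-assoc; ∨-zeroʳ)
open import Data.Bool.Solver using (module ∨-∧-Solver)
open import Data.List using (List; []; _∷_; _++_; length)
open import Data.List.Properties using (length-++; ∷-injective; ++-assoc)
open import Data.List.Membership.Propositional using (_∈_)
open import Data.List.Relation.Unary.Any using (here; there)
open import Data.List.Relation.Binary.Subset.Propositional using (_⊆_)
open import Data.List.Relation.Binary.Subset.Propositional.Properties using (xs⊆xs++ys; xs⊆ys++xs)
open import Data.Sum using (inj₁; inj₂)
open import Data.Empty using (⊥-elim)
open import Data.Maybe using (Maybe; just; nothing; maybe′; is-just)
import Data.Maybe as Maybe
open import Data.Maybe.Properties using (just-injective; map-id; map-∘)
open import Data.Nat using (ℕ; suc; _+_; _≡ᵇ_)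
open import Data.Nat.Properties using (≡ᵇ⇒≡; +-assoc; +-commutativeSemigroup; suc-injective)
open import Algebra.Properties.CommutativeSemigroup +-commutativeSemigroup using (interchange)
open import Data.Integer using (ℤ; +_) renaming (_+_ to _+ℤ_; _-_ to _-ℤ_; _≟_ to _≟ℤ_)
open import Data.Integer.Properties using (pos-+)
open import Data.Integer.Solver using (module +-*-Solver)
open import Data.Product using (_×_; _,_; proj₁; proj₂; ∃-syntax)
open import Data.Product.Properties using (≡-dec)
open import Function.Base using (_∘_; id)
open import Function.Bundles using (Equivalence)
open import Relation.Binary.Definitions using (DecidableEquality)
open import Relation.Binary.PropositionalEquality
open import Relation.Nullary using (¬_; yes; no; does)
open import Relation.Nullary.Decidable using (toWitness; isYes)

∼̈-refl : ∀ w → w ∼̈ w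
∼̈-refl w = record
  { ψ = id ; ψ-into = id ; ψ-inj = λ _ _ e → e ; ψ-onto = λ r → _ , r , refl ; ψ-base = refl
  ; ψ-wt = λ _ → refl ; ψ-ε = λ _ _ → refl ; ψ-φ = λ _ _ → refl
  ; ψ-ë = λ {x} i _ → sym (map-id (ë i x)) ; ψ-f̈ = λ {x} i _ → sym (map-id (f̈ i x)) }

∼̈-trans : ∀ {u v w} → u ∼̈ v → v ∼̈ w → u ∼̈ w
∼̈-trans {u} {v} {w} H₁ H₂ = record
  { ψ = ψ₂ ∘ ψ₁
  ; ψ-into = into₂ ∘ into₁
  ; ψ-inj = λ rx ry e → injective₁ rx ry (injective₂ (into₁ rx) (into₁ ry) e)
  ; ψ-onto = onto
  ; ψ-base = trans (cong ψ₂ base₁) base₂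
  ; ψ-wt = λ r → trans (wt₂ (into₁ r)) (wt₁ r)
  ; ψ-ε = λ i r → trans (ε₂ i (into₁ r)) (ε₁ i r)
  ; ψ-φ = λ i r → trans (φ₂ i (into₁ r)) (φ₁ i r)
  ; ψ-ë = λ {x} i r → trans (ë₂ i (into₁ r)) (trans (cong (Maybe.map ψ₂) (ë₁ i r)) (sym (map-∘ (ë i x))))
  ; ψ-f̈ = λ {x} i r → trans (f̈₂ i (into₁ r)) (trans (cong (Maybe.map ψ₂) (f̈₁ i r)) (sym (map-∘ (f̈ i x))))
  }
  where
  open Hypo H₁ renaming (ψ to ψ₁; ψ-into to into₁; ψ-inj to injective₁; ψ-onto to onto₁; ψ-base to base₁;
                         ψ-wt to wt₁; ψ-ε to ε₁; ψ-φ to φ₁; ψ-ë to ë₁; ψ-f̈ to f̈₁)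
  open Hypo H₂ renaming (ψ to ψ₂; ψ-into to into₂; ψ-inj to injective₂; ψ-onto to onto₂; ψ-base to base₂;
                         ψ-wt to wt₂; ψ-ε to ε₂; ψ-φ to φ₂; ψ-ë to ë₂; ψ-f̈ to f̈₂)
  onto : ∀ {y} → Reach w y → ∃[ x ] (Reach u x × ψ₂ (ψ₁ x) ≡ y)
  onto r with onto₂ r
  ... | y' , ry' , refl with onto₁ ry'
  ...   | x , rx , refl = x , rx , refl

record Simulation (w : Word) : Set₁ where
  field
    Inv   : Word → Set
    ψ     : Word → Word
    base  : Inv w
    inv-ë : ∀ {x y} i → Inv x → ë i x ≡ just y → Inv y
    inv-f̈ : ∀ {x y} i → Inv x → f̈ i x ≡ just y → Inv y
    ψ-injective : ∀ {x y} → Inv x → Inv y → ψ x ≡ ψ y → x ≡ y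
    ψ-wt : ∀ {x} → Inv x → wt (ψ x) ≡ wt x
    ψ-ε  : ∀ {x} i → Inv x → ε̈ i (ψ x) ≡ ε̈ i x
    ψ-φ  : ∀ {x} i → Inv x → φ̈ i (ψ x) ≡ φ̈ i x
    ψ-ë  : ∀ {x} i → Inv x → ë i (ψ x) ≡ Maybe.map ψ (ë i x)
    ψ-f̈  : ∀ {x} i → Inv x → f̈ i (ψ x) ≡ Maybe.map ψ (f̈ i x)

  reach-inv : ∀ {x} → Reach w x → Inv x
  reach-inv here           = base
  reach-inv (stepE i r e) = inv-ë i (reach-inv r) e
  reach-inv (stepF i r e) = inv-f̈ i (reach-inv r) e

  into : ∀ {x} → Reach w x → Reach (ψ w) (ψ x)
  into here           = here
  into (stepE i r e) = stepE i (into r) (trans (ψ-ë i (reach-inv r)) (cong (Maybe.map ψ) e))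
  into (stepF i r e) = stepF i (into r) (trans (ψ-f̈ i (reach-inv r)) (cong (Maybe.map ψ) e))

  lift : ∀ {x y} (op : Word → Maybe Word) → op (ψ x) ≡ Maybe.map ψ (op x) → op (ψ x) ≡ just y →
         (∀ {x'} → op x ≡ just x' → Reach w x') → ∃[ x' ] (Reach w x' × ψ x' ≡ y)
  lift {x} op commutes e step with op x
  ... | just x' = x' , step refl , just-injective (trans (sym commutes) e)
  ... | nothing with () ← trans (sym e) commutes

  onto : ∀ {y} → Reach (ψ w) y → ∃[ x ] (Reach w x × ψ x ≡ y)
  onto here = w , here , refl
  onto (stepE i r e) with onto r
  ... | x , rx , refl = lift (ë i) (ψ-ë i (reach-inv rx)) e (stepE i rx)
  onto (stepF i r e) with onto r
  ... | x , rx , refl = lift (f̈ i) (ψ-f̈ i (reach-inv rx)) e (stepF i rx)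

  isomorphism : w ∼̈ ψ w
  isomorphism = record
    { ψ = ψ ; ψ-into = into ; ψ-inj = λ rx ry → ψ-injective (reach-inv rx) (reach-inv ry)
    ; ψ-onto = onto ; ψ-base = refl ; ψ-wt = ψ-wt ∘ reach-inv
    ; ψ-ε = λ i → ψ-ε i ∘ reach-inv ; ψ-φ = λ i → ψ-φ i ∘ reach-inv
    ; ψ-ë = λ i → ψ-ë i ∘ reach-inv ; ψ-f̈ = λ i → ψ-f̈ i ∘ reach-inv }

pairWord : Letter × Letter → Word
pairWord (x , y) = x ∷ y ∷ []

plug : Word → Letter × Letter → Word → Word
plug A p C = A ++ pairWord p ++ C

record ReplacesOne (g : Letter → Maybe Letter) (w w' : Word) : Set where
  constructor replacing
  field
    {prefix suffix} : Word
    {old new}       : Letter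
    maps   : g old ≡ just new
    before : w ≡ prefix ++ old ∷ suffix
    after  : w' ≡ prefix ++ new ∷ suffix

module _ (g : Letter → Maybe Letter) where

  replaceRight-++ : ∀ A B → replaceRight g (A ++ B)
    ≡ maybe′ (λ B' → just (A ++ B')) (Maybe.map (_++ B) (replaceRight g A)) (replaceRight g B)
  replaceRight-++ []      B with replaceRight g B
  ... | just _  = refl
  ... | nothing = refl
  replaceRight-++ (a ∷ A) B with replaceRight g B | replaceRight-++ A B
  ... | just B' | e rewrite e = refl
  ... | nothing | e rewrite e with replaceRight g A
  ...   | just _  = refl
  ...   | nothing with g a
  ...     | just _  = refl
  ...     | nothing = refl

  replaceLeft-++ : ∀ A B → replaceLeft g (A ++ B)
    ≡ maybe′ (λ A' → just (A' ++ B)) (Maybe.map (A ++_) (replaceLeft g B)) (replaceLeft g A)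
  replaceLeft-++ []      B with replaceLeft g B
  ... | just _  = refl
  ... | nothing = refl
  replaceLeft-++ (a ∷ A) B with g a
  ... | just _  = refl
  ... | nothing rewrite replaceLeft-++ A B with replaceLeft g A
  ...   | just _  = refl
  ...   | nothing with replaceLeft g B
  ...     | just _  = refl
  ...     | nothing = refl

  anyB-replaceRight : ∀ w → anyB (is-just ∘ g) w ≡ is-just (replaceRight g w)
  anyB-replaceRight []      = refl
  anyB-replaceRight (a ∷ w) with replaceRight g w | anyB-replaceRight w
  ... | just _  | e rewrite e = ∨-zeroʳ (is-just (g a))
  ... | nothing | e rewrite e with g a
  ...   | just _  = refl
  ...   | nothing = refl

  anyB-replaceLeft : ∀ w → anyB (is-just ∘ g) w ≡ is-just (replaceLeft g w)
  anyB-replaceLeft []      = refl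
  anyB-replaceLeft (a ∷ w) with g a
  ... | just _  = refl
  ... | nothing rewrite anyB-replaceLeft w with replaceLeft g w
  ...   | just _  = refl
  ...   | nothing = refl

  replacesOne-∷ : ∀ {a w w'} → ReplacesOne g w w' → ReplacesOne g (a ∷ w) (a ∷ w')
  replacesOne-∷ {a} (replacing {prefix} m refl refl) = replacing {prefix = a ∷ prefix} m refl refl

  replaceRight-replacesOne : ∀ {w w'} → replaceRight g w ≡ just w' → ReplacesOne g w w'
  replaceRight-replacesOne {a ∷ w} e with replaceRight g w in ew
  ... | just _ with refl ← e = replacesOne-∷ (replaceRight-replacesOne ew)
  ... | nothing with g a in ga
  ...   | just _ with refl ← e = replacing {prefix = []} ga refl refl

  replaceLeft-replacesOne : ∀ {w w'} → replaceLeft g w ≡ just w' → ReplacesOne g w w'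
  replaceLeft-replacesOne {a ∷ w} e with g a in ga
  ... | just _ with refl ← e = replacing {prefix = []} ga refl refl
  ... | nothing with replaceLeft g w in ew
  ...   | just _ with refl ← e = replacesOne-∷ (replaceLeft-replacesOne ew)

  replacesOne-length : ∀ {w w'} → ReplacesOne g w w' → length w' ≡ length w
  replacesOne-length (replacing {prefix} {suffix} _ refl refl) =
    trans (length-++ prefix) (sym (length-++ prefix))

  replacePairRight replacePairLeft : Letter × Letter → Maybe (Letter × Letter)
  replacePairRight (x , y) with g y
  ... | just y' = just (x , y')
  ... | nothing = Maybe.map (_, y) (g x)
  replacePairLeft (x , y) with g x
  ... | just x' = just (x' , y)
  ... | nothing = Maybe.map (x ,_) (g y)

  replaceRight-pair : ∀ p → replaceRight g (pairWord p) ≡ Maybe.map pairWord (replacePairRight p)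
  replaceRight-pair (x , y) with g y
  ... | just _  = refl
  ... | nothing with g x
  ...   | just _  = refl
  ...   | nothing = refl

  replaceLeft-pair : ∀ p → replaceLeft g (pairWord p) ≡ Maybe.map pairWord (replacePairLeft p)
  replaceLeft-pair (x , y) with g x
  ... | just _  = refl
  ... | nothing with g y
  ...   | just _  = refl
  ...   | nothing = refl

  replaceRight-plug : ∀ A p C → replaceRight g (plug A p C)
    ≡ maybe′ (λ C' → just (plug A p C'))
             (maybe′ (λ p' → just (plug A p' C)) (Maybe.map (λ A' → plug A' p C) (replaceRight g A))
                     (replacePairRight p))
             (replaceRight g C)
  replaceRight-plug A p C
    rewrite replaceRight-++ A (pairWord p ++ C) | replaceRight-++ (pairWord p) C | replaceRight-pair p
    with replaceRight g C | replacePairRight p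
  ... | just _  | _       = refl
  ... | nothing | just _  = refl
  ... | nothing | nothing = refl

  replaceLeft-plug : ∀ A p C → replaceLeft g (plug A p C)
    ≡ maybe′ (λ A' → just (plug A' p C))
             (maybe′ (λ p' → just (plug A p' C)) (Maybe.map (plug A p) (replaceLeft g C))
                     (replacePairLeft p))
             (replaceLeft g A)
  replaceLeft-plug A p C
    rewrite replaceLeft-++ A (pairWord p ++ C) | replaceLeft-++ (pairWord p) C | replaceLeft-pair p
    with replaceLeft g A | replacePairLeft p
  ... | just _  | _       = refl
  ... | nothing | just _  = refl
  ... | nothing | nothing with replaceLeft g C
  ...   | just _  = refl
  ...   | nothing = refl

count-∷ : ∀ a b w → count a (b ∷ w) ≡ count a (b ∷ []) + count a w
count-∷ l1  l1  _ = refl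
count-∷ l1  l2  _ = refl
count-∷ l1  l2̄ _ = refl
count-∷ l1  l1̄ _ = refl
count-∷ l2  l1  _ = refl
count-∷ l2  l2  _ = refl
count-∷ l2  l2̄ _ = refl
count-∷ l2  l1̄ _ = refl
count-∷ l2̄ l1  _ = refl
count-∷ l2̄ l2  _ = refl
count-∷ l2̄ l2̄ _ = refl
count-∷ l2̄ l1̄ _ = refl
count-∷ l1̄ l1  _ = refl
count-∷ l1̄ l2  _ = refl
count-∷ l1̄ l2̄ _ = refl
count-∷ l1̄ l1̄ _ = refl

count-++ : ∀ a A B → count a (A ++ B) ≡ count a A + count a B
count-++ a []      B = refl
count-++ a (b ∷ A) B = begin
  count a (b ∷ A ++ B)                      ≡⟨ count-∷ a b (A ++ B) ⟩
  count a (b ∷ []) + count a (A ++ B)       ≡⟨ cong (λ k → count a (b ∷ []) + k) (count-++ a A B) ⟩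
  count a (b ∷ []) + (count a A + count a B) ≡⟨ sym (+-assoc (count a (b ∷ [])) _ _) ⟩
  (count a (b ∷ []) + count a A) + count a B ≡⟨ cong (_+ count a B) (sym (count-∷ a b A)) ⟩
  count a (b ∷ A) + count a B               ∎
  where open ≡-Reasoning

_+ʷ_ : ℤ × ℤ → ℤ × ℤ → ℤ × ℤ
(a , b) +ʷ (c , d) = (a +ℤ c , b +ℤ d)

wt-++ : ∀ A B → wt (A ++ B) ≡ wt A +ʷ wt B
wt-++ A B = cong₂ _,_ (difference l1 l1̄) (difference l2 l2̄)
  where
  difference : ∀ a b → + count a (A ++ B) -ℤ + count b (A ++ B)
                     ≡ (+ count a A -ℤ + count b A) +ℤ (+ count a B -ℤ + count b B)
  difference a b rewrite count-++ a A B | count-++ b A B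
                       | pos-+ (count a A) (count a B) | pos-+ (count b A) (count b B) =
    solve 4 (λ p q r s → (p :+ q) :- (r :+ s) := (p :- r) :+ (q :- s)) refl
      (+ count a A) (+ count a B) (+ count b A) (+ count b B)
    where open +-*-Solver

xCount yCount : Idx → Word → ℕ
xCount i1 w = count l1 w + count l2̄ w
xCount i2 w = count l2 w
yCount i1 w = count l2 w + count l1̄ w
yCount i2 w = count l2̄ w

ε̈-yCount : ∀ i w → ε̈ i w ≡ (if hasInv i w then ∞ else fin (yCount i w))
ε̈-yCount i1 w = refl
ε̈-yCount i2 w = refl

φ̈-xCount : ∀ i w → φ̈ i w ≡ (if hasInv i w then ∞ else fin (xCount i w))
φ̈-xCount i1 w = refl
φ̈-xCount i2 w = refl

count₂-++ : ∀ a b A B →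
  count a (A ++ B) + count b (A ++ B) ≡ (count a A + count b A) + (count a B + count b B)
count₂-++ a b A B rewrite count-++ a A B | count-++ b A B =
  interchange (count a A) (count a B) (count b A) (count b B)

xCount-++ : ∀ i A B → xCount i (A ++ B) ≡ xCount i A + xCount i B
xCount-++ i1 = count₂-++ l1 l2̄
xCount-++ i2 = count-++ l2

yCount-++ : ∀ i A B → yCount i (A ++ B) ≡ yCount i A + yCount i B
yCount-++ i1 = count₂-++ l2 l1̄
yCount-++ i2 = count-++ l2̄

_≟ˡ_ : DecidableEquality Letter
l1  ≟ˡ l1  = yes refl
l1  ≟ˡ l2  = no λ ()
l1  ≟ˡ l2̄ = no λ ()
l1  ≟ˡ l1̄ = no λ ()
l2  ≟ˡ l1  = no λ ()
l2  ≟ˡ l2  = yes refl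
l2  ≟ˡ l2̄ = no λ ()
l2  ≟ˡ l1̄ = no λ ()
l2̄ ≟ˡ l1  = no λ ()
l2̄ ≟ˡ l2  = no λ ()
l2̄ ≟ˡ l2̄ = yes refl
l2̄ ≟ˡ l1̄ = no λ ()
l1̄ ≟ˡ l1  = no λ ()
l1̄ ≟ˡ l2  = no λ ()
l1̄ ≟ˡ l2̄ = no λ ()
l1̄ ≟ˡ l1̄ = yes refl

_==_ : Letter → Letter → Bool
a == b = does (a ≟ˡ b)

infixr 5 _⇒_
_⇒_ : Bool → Bool → Bool
a ⇒ b = not a ∨ b

⇒-elim : ∀ {a b} → T (a ⇒ b) → T a → T b
⇒-elim {true} h _ = h

∧-elimˡ : ∀ {a b} → T (a ∧ b) → T a
∧-elimˡ h = proj₁ (Equivalence.to T-∧ h)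

∧-elimʳ : ∀ {a b} → T (a ∧ b) → T b
∧-elimʳ h = proj₂ (Equivalence.to T-∧ h)

∧-intro : ∀ {a b} → T a → T b → T (a ∧ b)
∧-intro ta tb = Equivalence.from T-∧ (ta , tb)

∨-introˡ : ∀ {a b} → T a → T (a ∨ b)
∨-introˡ ta = Equivalence.from T-∨ (inj₁ ta)

∨-introʳ : ∀ {a b} → T b → T (a ∨ b)
∨-introʳ tb = Equivalence.from T-∨ (inj₂ tb)

∨-resolve : ∀ {a b} → T (a ∨ b) → ¬ T a → T b
∨-resolve {true}  _ ¬a = ⊥-elim (¬a _)
∨-resolve {false} h _  = h

==-refl : ∀ x → T (x == x)
==-refl x with x ≟ˡ x
... | yes _  = _
... | no x≢x = x≢x refl

==-sound : ∀ a b → T (a == b) → a ≡ b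
==-sound a b h with a ≟ˡ b
... | yes a≡b = a≡b

infix 4 _=ᵖ_
_=ᵖ_ : Letter × Letter → Letter × Letter → Bool
(x , y) =ᵖ (x' , y') = (x == x') ∧ (y == y')

=ᵖ-sound : ∀ p q → T (p =ᵖ q) → p ≡ q
=ᵖ-sound (x , y) (x' , y') h = cong₂ _,_ (==-sound x x' (∧-elimˡ h)) (==-sound y y' (∧-elimʳ {x == x'} h))

infix 4 _⇔_
_⇔_ : Bool → Bool → Bool
true  ⇔ b = b
false ⇔ b = not b

⇔-sound : ∀ a b → T (a ⇔ b) → a ≡ b
⇔-sound true  true  _ = refl
⇔-sound false false _ = refl

⇔-∧ : ∀ {a a' r} → T ((a ⇔ a') ∧ r) → a ≡ a' × T r
⇔-∧ {true}  {true}  h = refl , h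
⇔-∧ {false} {false} h = refl , h

∀ᵇ : (Bool → Bool) → Bool
∀ᵇ p = p true ∧ p false

∀ᵇ-elim : ∀ p → T (∀ᵇ p) → ∀ b → T (p b)
∀ᵇ-elim p h true  = ∧-elimˡ {p true} h
∀ᵇ-elim p h false = ∧-elimʳ {p true} h

∀ˡ : (Letter → Bool) → Bool
∀ˡ p = p l1 ∧ p l2 ∧ p l2̄ ∧ p l1̄

∀ˡ-elim : ∀ p → T (∀ˡ p) → ∀ a → T (p a)
∀ˡ-elim p h l1  = ∧-elimˡ {p l1} h
∀ˡ-elim p h l2  = ∧-elimˡ {p l2} (∧-elimʳ {p l1} h)
∀ˡ-elim p h l2̄ = ∧-elimˡ {p l2̄} (∧-elimʳ {p l2} (∧-elimʳ {p l1} h))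
∀ˡ-elim p h l1̄ = ∧-elimʳ {p l2̄} (∧-elimʳ {p l2} (∧-elimʳ {p l1} h))

-- Summaries of words

record Summary : Set where
  constructor summaryOf
  field
    has₁ has₂ has₂̄ has₁̄ inv₁ inv₂ : Bool
open Summary

∀ˢ : (Summary → Bool) → Bool
∀ˢ p = ∀ᵇ λ a → ∀ᵇ λ b → ∀ᵇ λ c → ∀ᵇ λ d → ∀ᵇ λ e → ∀ᵇ λ f → p (summaryOf a b c d e f)

∀ˢ-elim : ∀ p → T (∀ˢ p) → ∀ s → T (p s)
∀ˢ-elim p h (summaryOf a b c d e f) =
  ∀ᵇ-elim (λ f → p (summaryOf a b c d e f))
  (∀ᵇ-elim (λ e → ∀ᵇ λ f → p (summaryOf a b c d e f))
  (∀ᵇ-elim (λ d → ∀ᵇ λ e → ∀ᵇ λ f → p (summaryOf a b c d e f))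
  (∀ᵇ-elim (λ c → ∀ᵇ λ d → ∀ᵇ λ e → ∀ᵇ λ f → p (summaryOf a b c d e f))
  (∀ᵇ-elim (λ b → ∀ᵇ λ c → ∀ᵇ λ d → ∀ᵇ λ e → ∀ᵇ λ f → p (summaryOf a b c d e f))
  (∀ᵇ-elim (λ a → ∀ᵇ λ b → ∀ᵇ λ c → ∀ᵇ λ d → ∀ᵇ λ e → ∀ᵇ λ f → p (summaryOf a b c d e f))
   h a) b) c) d) e) f

occurs : Letter → Summary → Bool
occurs l1  = has₁
occurs l2  = has₂
occurs l2̄ = has₂̄
occurs l1̄ = has₁̄

hasX hasY inv : Idx → Summary → Bool
hasX i1 s = has₁ s ∨ has₂̄ s
hasX i2 s = has₂ s
hasY i1 s = has₂ s ∨ has₁̄ s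
hasY i2 s = has₂̄ s
inv i1 = inv₁
inv i2 = inv₂

infixr 6 _⊙_
_⊙_ : Summary → Summary → Summary
s ⊙ t = summaryOf (has₁ s ∨ has₁ t) (has₂ s ∨ has₂ t) (has₂̄ s ∨ has₂̄ t) (has₁̄ s ∨ has₁̄ t)
                  ((inv₁ s ∨ (hasX i1 s ∧ hasY i1 t)) ∨ inv₁ t)
                  ((inv₂ s ∨ (hasX i2 s ∧ hasY i2 t)) ∨ inv₂ t)

summary : Word → Summary
summary w = summaryOf (anyB (l1 ==_) w) (anyB (l2 ==_) w) (anyB (l2̄ ==_) w) (anyB (l1̄ ==_) w)
                      (hasInv i1 w) (hasInv i2 w)

⟦_⟧ : Letter → Summary
⟦ a ⟧ = summary (a ∷ [])

occurs-summary : ∀ x w → occurs x (summary w) ≡ anyB (x ==_) w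
occurs-summary l1  w = refl
occurs-summary l2  w = refl
occurs-summary l2̄ w = refl
occurs-summary l1̄ w = refl

hasInv-summary : ∀ i w → hasInv i w ≡ inv i (summary w)
hasInv-summary i1 w = refl
hasInv-summary i2 w = refl

anyB-++ : ∀ p (A B : Word) → anyB p (A ++ B) ≡ anyB p A ∨ anyB p B
anyB-++ p []      B = refl
anyB-++ p (a ∷ A) B rewrite anyB-++ p A B = sym (∨-assoc (p a) (anyB p A) (anyB p B))

anyB-∨ : ∀ p q (w : Word) → anyB (λ a → p a ∨ q a) w ≡ anyB p w ∨ anyB q w
anyB-∨ p q []      = refl
anyB-∨ p q (a ∷ w) rewrite anyB-∨ p q w =
  solve 4 (λ pa qa P Q → (pa :+ qa) :+ (P :+ Q) := (pa :+ P) :+ (qa :+ Q)) refl (p a) (q a) (anyB p w) (anyB q w)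
  where open ∨-∧-Solver

anyB-cong : ∀ {p q} → (∀ a → p a ≡ q a) → (w : Word) → anyB p w ≡ anyB q w
anyB-cong e []      = refl
anyB-cong e (a ∷ w) = cong₂ _∨_ (e a) (anyB-cong e w)

anyX-summary : ∀ i w → anyB (isX i) w ≡ hasX i (summary w)
anyX-summary i1 w = trans (anyB-cong isX₁ w) (anyB-∨ (l1 ==_) (l2̄ ==_) w)
  where
  isX₁ : ∀ a → isX i1 a ≡ (l1 == a) ∨ (l2̄ == a)
  isX₁ l1 = refl
  isX₁ l2 = refl
  isX₁ l2̄ = refl
  isX₁ l1̄ = refl
anyX-summary i2 w = anyB-cong isX₂ w
  where
  isX₂ : ∀ a → isX i2 a ≡ (l2 == a)
  isX₂ l1 = refl
  isX₂ l2 = refl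
  isX₂ l2̄ = refl
  isX₂ l1̄ = refl

anyY-summary : ∀ i w → anyB (isY i) w ≡ hasY i (summary w)
anyY-summary i1 w = trans (anyB-cong isY₁ w) (anyB-∨ (l2 ==_) (l1̄ ==_) w)
  where
  isY₁ : ∀ a → isY i1 a ≡ (l2 == a) ∨ (l1̄ == a)
  isY₁ l1 = refl
  isY₁ l2 = refl
  isY₁ l2̄ = refl
  isY₁ l1̄ = refl
anyY-summary i2 w = anyB-cong isY₂ w
  where
  isY₂ : ∀ a → isY i2 a ≡ (l2̄ == a)
  isY₂ l1 = refl
  isY₂ l2 = refl
  isY₂ l2̄ = refl
  isY₂ l1̄ = refl

hasY-replaceRight : ∀ i w → hasY i (summary w) ≡ is-just (replaceRight (eL i) w)
hasY-replaceRight i w = trans (sym (anyY-summary i w)) (anyB-replaceRight (eL i) w)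

hasX-replaceLeft : ∀ i w → hasX i (summary w) ≡ is-just (replaceLeft (fL i) w)
hasX-replaceLeft i w = trans (sym (anyX-summary i w)) (anyB-replaceLeft (fL i) w)

hasInv-++ : ∀ i (A B : Word) →
  hasInv i (A ++ B) ≡ (hasInv i A ∨ (anyB (isX i) A ∧ anyB (isY i) B)) ∨ hasInv i B
hasInv-++ i []      B = refl
hasInv-++ i (a ∷ A) B rewrite anyB-++ (isY i) A B | hasInv-++ i A B =
  solve 6 (λ x yA yB xA hA hB → (x :* (yA :+ yB)) :+ ((hA :+ (xA :* yB)) :+ hB)
                               := (((x :* yA) :+ hA) :+ ((x :+ xA) :* yB)) :+ hB)
    refl (isX i a) (anyB (isY i) A) (anyB (isY i) B) (anyB (isX i) A) (hasInv i A) (hasInv i B)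
  where open ∨-∧-Solver

summary-++ : ∀ A B → summary (A ++ B) ≡ summary A ⊙ summary B
summary-++ A B
  rewrite anyB-++ (l1 ==_) A B | anyB-++ (l2 ==_) A B | anyB-++ (l2̄ ==_) A B | anyB-++ (l1̄ ==_) A B
        | hasInv-++ i1 A B | hasInv-++ i2 A B
        | anyX-summary i1 A | anyY-summary i1 B | anyX-summary i2 A | anyY-summary i2 B = refl

summary-∷ : ∀ a w → summary (a ∷ w) ≡ ⟦ a ⟧ ⊙ summary w
summary-∷ a w = summary-++ (a ∷ []) w

summary-split : ∀ A ℓ B → summary (A ++ ℓ ∷ B) ≡ summary A ⊙ ⟦ ℓ ⟧ ⊙ summary B
summary-split A ℓ B = trans (summary-++ A (ℓ ∷ B)) (cong (summary A ⊙_) (summary-∷ ℓ B))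

-- Exactly the summaries of words: a 2 and a 2̄ always form an inversion,
-- a 2-inversion if the 2 comes first and a 1-inversion otherwise.
realizable : Summary → Bool
realizable s = (inv₁ s ⇒ hasX i1 s ∧ hasY i1 s) ∧ (inv₂ s ⇒ hasX i2 s ∧ hasY i2 s)
             ∧ (hasX i2 s ∧ hasY i2 s ⇒ inv₁ s ∨ inv₂ s)

∀ʳ : (Summary → Bool) → Bool
∀ʳ p = ∀ˢ λ s → realizable s ⇒ p s

realizable-∷ : T (∀ˡ λ a → ∀ʳ λ s → realizable (⟦ a ⟧ ⊙ s))
realizable-∷ = _

summary-realizable : ∀ w → T (realizable (summary w))
summary-realizable []      = _
summary-realizable (a ∷ w) = subst (T ∘ realizable) (sym (summary-∷ a w))
  (⇒-elim (∀ˢ-elim (λ s → realizable s ⇒ realizable (⟦ a ⟧ ⊙ s))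
                    (∀ˡ-elim (λ a → ∀ʳ λ s → realizable (⟦ a ⟧ ⊙ s)) realizable-∷ a) (summary w))
          (summary-realizable w))

∀ʳ-elim : ∀ p → T (∀ʳ p) → ∀ w → T (p (summary w))
∀ʳ-elim p h w = ⇒-elim (∀ˢ-elim (λ s → realizable s ⇒ p s) h (summary w)) (summary-realizable w)

-- Abstract configurations (summary A, (x , y), summary C) of words A x y C.
∀ᶜ : (Summary → Letter × Letter → Summary → Bool) → Bool
∀ᶜ P = ∀ʳ λ sA → ∀ˡ λ x → ∀ˡ λ y → ∀ʳ λ sC → P sA (x , y) sC

∀ᶜ-elim : ∀ P → T (∀ᶜ P) → ∀ A p C → T (P (summary A) p (summary C))
∀ᶜ-elim P h A (x , y) C =
  ∀ʳ-elim (P sA (x , y)) (∀ˡ-elim (λ y → ∀ʳ (P sA (x , y))) (∀ˡ-elim (λ x → ∀ˡ λ y → ∀ʳ (P sA (x , y)))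
    (∀ʳ-elim (λ sA → ∀ˡ λ x → ∀ˡ λ y → ∀ʳ (P sA (x , y))) h A) x) y) C
  where sA = summary A

∈⇒occurs : ∀ {x w} → x ∈ w → T (occurs x (summary w))
∈⇒occurs {x} {w} x∈w = subst T (sym (occurs-summary x w)) (anyB-∈ x∈w)
  where
  anyB-∈ : ∀ {w} → x ∈ w → T (anyB (x ==_) w)
  anyB-∈ (here refl) = ∨-introˡ (==-refl x)
  anyB-∈ (there x∈w) = ∨-introʳ {x == _} (anyB-∈ x∈w)

infix 4 _=ˢ_
_=ˢ_ : Summary → Summary → Bool
s =ˢ t = (has₁ s ⇔ has₁ t) ∧ (has₂ s ⇔ has₂ t) ∧ (has₂̄ s ⇔ has₂̄ t) ∧ (has₁̄ s ⇔ has₁̄ t)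
       ∧ (inv₁ s ⇔ inv₁ t) ∧ (inv₂ s ⇔ inv₂ t)

=ˢ-sound : ∀ s t → T (s =ˢ t) → s ≡ t
=ˢ-sound (summaryOf a b c d e f) (summaryOf a' b' c' d' e' f') h₁
  with ⇔-∧ {a} h₁
... | refl , h₂ with ⇔-∧ {b} h₂
... | refl , h₃ with ⇔-∧ {c} h₃
... | refl , h₄ with ⇔-∧ {d} h₄
... | refl , h₅ with ⇔-∧ {e} h₅
... | refl , h₆ with ⇔-sound f f' h₆
... | refl = refl

setOccurs : Letter → Bool → Summary → Summary
setOccurs l1  b s = record s { has₁ = b }
setOccurs l2  b s = record s { has₂ = b }
setOccurs l2̄ b s = record s { has₂̄ = b }
setOccurs l1̄ b s = record s { has₁̄ = b }

-- Replacing one occurrence of ℓ by ℓ' keeps the other letters, adds ℓ',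
-- possibly removes ℓ, and may change both inversion flags.
afterReplacing : Letter → Letter → Summary → Bool → Bool → Bool → Summary
afterReplacing ℓ ℓ' s keep f₁ f₂ = record (setOccurs ℓ' true (setOccurs ℓ keep s)) { inv₁ = f₁ ; inv₂ = f₂ }

isReplacement : Letter → Letter → Summary → Summary → Bool
isReplacement ℓ ℓ' s t = occurs ℓ s ∧ (t =ˢ afterReplacing ℓ ℓ' s (occurs ℓ t) (inv₁ t) (inv₂ t))

replacementCondition : Summary → Letter × Letter → Summary → Bool
replacementCondition s₁ (ℓ , ℓ') s₂ = isReplacement ℓ ℓ' (s₁ ⊙ ⟦ ℓ ⟧ ⊙ s₂) (s₁ ⊙ ⟦ ℓ' ⟧ ⊙ s₂)

replacement-summary : T (∀ᶜ replacementCondition)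
replacement-summary = _

∀afterReplacing : Letter → Letter → Summary → (Summary → Bool) → Bool
∀afterReplacing ℓ ℓ' s P = ∀ᵇ λ keep → ∀ᵇ λ f₁ → ∀ᵇ λ f₂ →
  realizable (afterReplacing ℓ ℓ' s keep f₁ f₂) ⇒ P (afterReplacing ℓ ℓ' s keep f₁ f₂)

∀afterReplacing-elim : ∀ P {ℓ ℓ' s} → T (∀afterReplacing ℓ ℓ' s P) → ∀ keep f₁ f₂ →
  T (realizable (afterReplacing ℓ ℓ' s keep f₁ f₂)) → T (P (afterReplacing ℓ ℓ' s keep f₁ f₂))
∀afterReplacing-elim P {ℓ} {ℓ'} {s} h keep f₁ f₂ = ⇒-elim (∀ᵇ-elim (λ f₂ → Q keep f₁ f₂)
  (∀ᵇ-elim (λ f₁ → ∀ᵇ (Q keep f₁)) (∀ᵇ-elim (λ keep → ∀ᵇ λ f₁ → ∀ᵇ (Q keep f₁)) h keep) f₁) f₂)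
  where
  Q : Bool → Bool → Bool → Bool
  Q keep f₁ f₂ = realizable (afterReplacing ℓ ℓ' s keep f₁ f₂) ⇒ P (afterReplacing ℓ ℓ' s keep f₁ f₂)

∀replacement : (Letter → Maybe Letter) → Summary → (Summary → Bool) → Bool
∀replacement g s P = ∀ˡ λ ℓ → maybe′ (λ ℓ' → occurs ℓ s ⇒ ∀afterReplacing ℓ ℓ' s P) true (g ℓ)

∀replacement-sound : ∀ g P {w w'} → ReplacesOne g w w' → T (∀replacement g (summary w) P) → T (P (summary w'))
∀replacement-sound g P (replacing {A} {B} {ℓ} {ℓ'} maps refl refl) h =
  subst (T ∘ P) (sym t≡) (∀afterReplacing-elim P {ℓ} {ℓ'} {s} at-ℓ (occurs ℓ t) (inv₁ t) (inv₂ t)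
    (subst (T ∘ realizable) t≡ (summary-realizable (A ++ ℓ' ∷ B))))
  where
  s t : Summary
  s = summary (A ++ ℓ ∷ B)
  t = summary (A ++ ℓ' ∷ B)
  replacement : T (isReplacement ℓ ℓ' s t)
  replacement = subst₂ (λ s t → T (isReplacement ℓ ℓ' s t)) (sym (summary-split A ℓ B)) (sym (summary-split A ℓ' B))
    (∀ᶜ-elim replacementCondition replacement-summary A (ℓ , ℓ') B)
  t≡ : t ≡ afterReplacing ℓ ℓ' s (occurs ℓ t) (inv₁ t) (inv₂ t)
  t≡ = =ˢ-sound _ _ (∧-elimʳ {occurs ℓ s} replacement)
  at-ℓ : T (∀afterReplacing ℓ ℓ' s P)
  at-ℓ = ⇒-elim {occurs ℓ s} (subst (T ∘ maybe′ (λ ℓ' → occurs ℓ s ⇒ ∀afterReplacing ℓ ℓ' s P) true) maps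
           (∀ˡ-elim (λ ℓ → maybe′ (λ ℓ' → occurs ℓ s ⇒ ∀afterReplacing ℓ ℓ' s P) true (g ℓ)) h ℓ))
           (∧-elimˡ replacement)

-- The transposition

-- A letter is determined by whether it is barred and by its 1-type,
-- X = {1, 2̄} or Y = {2, 1̄}.
barred : Letter → Bool
barred l1  = false
barred l2  = false
barred l2̄ = true
barred l1̄ = true

letter : Bool → Bool → Letter
letter false false = l1
letter false true  = l2
letter true  false = l2̄
letter true  true  = l1̄

letter-coordinates : ∀ a → letter (barred a) (isY i1 a) ≡ a
letter-coordinates l1  = refl
letter-coordinates l2  = refl
letter-coordinates l2̄ = refl
letter-coordinates l1̄ = refl

barred-letter : ∀ b t → barred (letter b t) ≡ b
barred-letter false false = refl
barred-letter false true  = refl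
barred-letter true  false = refl
barred-letter true  true  = refl

isY-letter : ∀ b t → isY i1 (letter b t) ≡ t
isY-letter false false = refl
isY-letter false true  = refl
isY-letter true  false = refl
isY-letter true  true  = refl

-- Without a 1-inversion the 1-types of a word read Y…YX…X, and the operators
-- ë₁, f̈₁ only move the border; so they stay in place and only the bars are swapped.
transpose : Bool → Letter × Letter → Letter × Letter
transpose true  (x , y) = y , x
transpose false (x , y) = letter (barred y) (isY i1 x) , letter (barred x) (isY i1 y)

transpose-involutive : ∀ b p → transpose b (transpose b p) ≡ p
transpose-involutive true  (x , y) = refl
transpose-involutive false (x , y)
  rewrite barred-letter (barred y) (isY i1 x) | isY-letter (barred x) (isY i1 y)
        | barred-letter (barred x) (isY i1 y) | isY-letter (barred y) (isY i1 x)
        | letter-coordinates x | letter-coordinates y = refl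

transposeAt : Bool → ℕ → Word → Word
transposeAt b 0       (x ∷ y ∷ w) = pairWord (transpose b (x , y)) ++ w
transposeAt b (suc n) (a ∷ w)     = a ∷ transposeAt b n w
transposeAt b _       w           = w

-- The candidate isomorphism, transposing the letters at positions n and n + 1.
ψ : ℕ → Word → Word
ψ n z = transposeAt (hasInv i1 z) n z

around : Summary → Letter × Letter → Summary → Summary
around sA (x , y) sC = sA ⊙ ⟦ x ⟧ ⊙ ⟦ y ⟧ ⊙ sC

summary-plug : ∀ A p C → summary (plug A p C) ≡ around (summary A) p (summary C)
summary-plug A (x , y) C = begin
  summary (A ++ x ∷ y ∷ C)                     ≡⟨ summary-++ A (x ∷ y ∷ C) ⟩
  summary A ⊙ summary (x ∷ y ∷ C)              ≡⟨ cong (summary A ⊙_) (summary-∷ x (y ∷ C)) ⟩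
  summary A ⊙ ⟦ x ⟧ ⊙ summary (y ∷ C)          ≡⟨ cong (λ s → summary A ⊙ ⟦ x ⟧ ⊙ s) (summary-∷ y C) ⟩
  summary A ⊙ ⟦ x ⟧ ⊙ ⟦ y ⟧ ⊙ summary C        ∎
  where open ≡-Reasoning

hasInv-plug : ∀ i A p C → hasInv i (plug A p C) ≡ inv i (around (summary A) p (summary C))
hasInv-plug i A p C = trans (hasInv-summary i (plug A p C)) (cong (inv i) (summary-plug A p C))

transposed : Summary → Letter × Letter → Summary → Letter × Letter
transposed sA p sC = transpose (inv₁ (around sA p sC)) p

transposeAt-plug : ∀ b A p C → transposeAt b (length A) (plug A p C) ≡ plug A (transpose b p) C
transposeAt-plug b []      (x , y) C = refl
transposeAt-plug b (a ∷ A) p       C = cong (a ∷_) (transposeAt-plug b A p C)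

ψ-plug : ∀ A p C → ψ (length A) (plug A p C) ≡ plug A (transposed (summary A) p (summary C)) C
ψ-plug A p C = trans (cong (λ s → transposeAt (inv₁ s) (length A) (plug A p C)) (summary-plug A p C))
                     (transposeAt-plug _ A p C)

plug-homomorphic : ∀ {M : Set} (_·_ : M → M → M) (f : Word → M) → (∀ A B → f (A ++ B) ≡ f A · f B) →
  ∀ A {p q} C → f (pairWord q) ≡ f (pairWord p) → f (plug A q C) ≡ f (plug A p C)
plug-homomorphic _·_ f hom A {p} {q} C e = begin
  f (A ++ pairWord q ++ C)        ≡⟨ hom A (pairWord q ++ C) ⟩
  f A · f (pairWord q ++ C)       ≡⟨ cong (f A ·_) (hom (pairWord q) C) ⟩
  f A · (f (pairWord q) · f C)    ≡⟨ cong (λ m → f A · (m · f C)) e ⟩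
  f A · (f (pairWord p) · f C)    ≡⟨ cong (f A ·_) (hom (pairWord p) C) ⟨
  f A · f (pairWord p ++ C)       ≡⟨ hom A (pairWord p ++ C) ⟨
  f (A ++ pairWord p ++ C)        ∎
  where open ≡-Reasoning

_≟ʷ_ : DecidableEquality (ℤ × ℤ)
_≟ʷ_ = ≡-dec _≟ℤ_ _≟ℤ_

transpose-weight : T (∀ᵇ λ b → ∀ˡ λ x → ∀ˡ λ y → isYes (wt (pairWord (transpose b (x , y))) ≟ʷ wt (x ∷ y ∷ [])))
transpose-weight = _

wt-transpose : ∀ b p → wt (pairWord (transpose b p)) ≡ wt (pairWord p)
wt-transpose b (x , y) = toWitness (∀ˡ-elim (λ y → P b x y) (∀ˡ-elim (λ x → ∀ˡ (P b x))
  (∀ᵇ-elim (λ b → ∀ˡ λ x → ∀ˡ (P b x)) transpose-weight b) x) y)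
  where
  P : Bool → Letter → Letter → Bool
  P b x y = isYes (wt (pairWord (transpose b (x , y))) ≟ʷ wt (x ∷ y ∷ []))

plug-injective : ∀ A A' {p p'} C C' → length A ≡ length A' → plug A p C ≡ plug A' p' C' →
  A ≡ A' × p ≡ p' × C ≡ C'
plug-injective [] [] C C' _ e with refl , e₁ ← ∷-injective e with refl , refl ← ∷-injective e₁ = refl , refl , refl
plug-injective (a ∷ A) (a' ∷ A') C C' len e with refl , e₁ ← ∷-injective e
  with refl , refl , refl ← plug-injective A A' C C' (suc-injective len) e₁ = refl , refl , refl

-- Admissible configurations

-- The invariant of the components, given as a certificate: it was found by
-- exploring the abstract configurations reachable from those of `transposition`
-- below, and is checked to be closed by `admissible-compatible`.  The two
-- Booleans are the inversion flags of the whole word.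
admissibleAt : Letter → Letter → Bool → Bool → Summary → Summary → Bool
admissibleAt l1  l2  true  false sA sC = has₁ sA ∧ (has₂ sA ∨ has₂̄ sA ∨ has₁̄ sA) ∧ has₁ sC ∧ has₂ sC
admissibleAt l1  l2  true  true  sA sC = has₂ sC
admissibleAt l1  l1̄ true  false sA sC = has₁̄ sC
admissibleAt l1  l1̄ true  true  sA sC = has₁̄ sC
admissibleAt l1  l2̄ false false sA sC = has₁ sA ∧ (has₂̄ sA ∨ has₁̄ sA) ∧ has₁ sC ∧ has₂̄ sC
admissibleAt l1  l2̄ false true  sA sC = (has₂̄ sA ∨ has₁̄ sA) ∧ has₁ sC ∧ has₂̄ sC
admissibleAt l1  l2̄ true  false sA sC = has₁ sA ∧ (has₂̄ sA ∨ has₁̄ sA) ∧ has₁ sC ∧ (has₂ sC ∨ has₂̄ sC)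
admissibleAt l1  l2̄ true  true  sA sC = true
admissibleAt l2  l1  true  false sA sC = has₁ sA ∧ (has₂ sA ∨ has₂̄ sA ∨ has₁̄ sA) ∧ has₁ sC ∧ has₂ sC
admissibleAt l2  l1  true  true  sA sC = true
admissibleAt l2  l1̄ false false sA sC = has₂ sA ∧ has₁̄ sA ∧ (has₁ sC ∨ has₂ sC) ∧ has₁̄ sC
admissibleAt l2  l1̄ false true  sA sC = has₂ sA ∧ has₁̄ sA ∧ (has₁ sC ∨ has₂ sC)
admissibleAt l2  l1̄ true  false sA sC = (has₂ sA ∨ has₂̄ sA) ∧ has₁̄ sA ∧ (has₁ sC ∨ has₂ sC) ∧ has₁̄ sC
admissibleAt l2  l1̄ true  true  sA sC = true
admissibleAt l2  l2̄ false true  sA sC = has₂ sA ∧ has₁̄ sA ∧ has₁ sC ∧ has₂̄ sC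
admissibleAt l2  l2̄ true  true  sA sC = has₂̄ sC
admissibleAt l1̄ l1  false true  sA sC = has₁̄ sA ∧ has₁ sC
admissibleAt l1̄ l1  true  false sA sC = has₁̄ sC
admissibleAt l1̄ l1  true  true  sA sC = true
admissibleAt l1̄ l2  false false sA sC = has₂ sA ∧ has₁̄ sA ∧ (has₁ sC ∨ has₂ sC) ∧ has₁̄ sC
admissibleAt l1̄ l2  false true  sA sC = has₂ sA ∧ has₁̄ sA ∧ (has₁ sC ∨ has₂ sC)
admissibleAt l1̄ l2  true  false sA sC = (has₂ sA ∨ has₂̄ sA) ∧ has₁̄ sA ∧ (has₁ sC ∨ has₂ sC) ∧ has₁̄ sC
admissibleAt l1̄ l2  true  true  sA sC = true
admissibleAt l1̄ l2̄ true  false sA sC = has₂̄ sA ∧ has₁̄ sA ∧ (has₁ sC ∨ has₂ sC ∨ has₂̄ sC) ∧ has₁̄ sC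
admissibleAt l1̄ l2̄ true  true  sA sC = true
admissibleAt l2̄ l1  false false sA sC = has₁ sA ∧ (has₂̄ sA ∨ has₁̄ sA) ∧ has₁ sC ∧ has₂̄ sC
admissibleAt l2̄ l1  false true  sA sC = (has₂̄ sA ∨ has₁̄ sA) ∧ has₁ sC ∧ has₂̄ sC
admissibleAt l2̄ l1  true  false sA sC = has₁ sA ∧ (has₂̄ sA ∨ has₁̄ sA) ∧ has₁ sC ∧ (has₂ sC ∨ has₂̄ sC)
admissibleAt l2̄ l1  true  true  sA sC = true
admissibleAt l2̄ l2  true  true  sA sC = has₂ sC
admissibleAt l2̄ l1̄ true  false sA sC = has₂̄ sA ∧ has₁̄ sA ∧ (has₁ sC ∨ has₂ sC ∨ has₂̄ sC) ∧ has₁̄ sC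
admissibleAt l2̄ l1̄ true  true  sA sC = has₁̄ sC
admissibleAt _ _ _ _ _ _ = false

admissible : Summary → Letter × Letter → Summary → Bool
admissible sA (x , y) sC = admissibleAt x y (inv₁ s) (inv₂ s) sA sC
  where s = around sA (x , y) sC

transposesTo : Summary → Letter × Letter → Summary → Letter × Letter → Bool
transposesTo sA p sC q = admissible sA p sC ∧ (transposed sA p sC =ᵖ q)

matchPairs : Summary → Summary → Maybe (Letter × Letter) → Maybe (Letter × Letter) → Bool → Bool
matchPairs sA sC (just q) (just q') _    = transposesTo sA q sC q'
matchPairs sA sC nothing  nothing   rest = rest
matchPairs _  _  _        _         _    = false

-- The rightmost letter of the domain of eL i lies in C, in the pair or in A, and
-- it must do so in A x y C and in its transposed word alike.
ë-compatibleAt : Idx → Bool → Summary → Letter × Letter → Summary → Bool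
ë-compatibleAt i true  sA p sC = ∀replacement (eL i) sC λ t → transposesTo sA p t (transposed sA p sC)
ë-compatibleAt i false sA p sC =
  matchPairs sA sC (replacePairRight (eL i) p) (replacePairRight (eL i) (transposed sA p sC))
    (∀replacement (eL i) sA λ t → transposesTo t p sC (transposed sA p sC))

f̈-compatibleAt : Idx → Bool → Summary → Letter × Letter → Summary → Bool
f̈-compatibleAt i true  sA p sC = ∀replacement (fL i) sA λ t → transposesTo t p sC (transposed sA p sC)
f̈-compatibleAt i false sA p sC =
  matchPairs sA sC (replacePairLeft (fL i) p) (replacePairLeft (fL i) (transposed sA p sC))
    (∀replacement (fL i) sC λ t → transposesTo sA p t (transposed sA p sC))

sameCounts : Idx → Letter × Letter → Letter × Letter → Bool
sameCounts i p q =
  (xCount i (pairWord q) ≡ᵇ xCount i (pairWord p)) ∧ (yCount i (pairWord q) ≡ᵇ yCount i (pairWord p))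

compatible : Idx → Summary → Letter × Letter → Summary → Bool
compatible i sA p sC =
  (inv i (around sA q sC) ⇔ inv i (around sA p sC))
  ∧ (not (inv i (around sA p sC)) ⇒
       sameCounts i p q ∧ ë-compatibleAt i (hasY i sC) sA p sC ∧ f̈-compatibleAt i (hasX i sA) sA p sC)
  where q = transposed sA p sC

admissible-compatible : ∀ i → T (∀ᶜ λ sA p sC → admissible sA p sC ⇒ compatible i sA p sC)
admissible-compatible i1 = _
admissible-compatible i2 = _

record Admissible (n : ℕ) (z : Word) : Set where
  constructor admissible-at
  field
    {A C}    : Word
    {pair}   : Letter × Letter
    shape    : z ≡ plug A pair C
    position : length A ≡ n
    config   : T (admissible (summary A) pair (summary C))

data Related (n : ℕ) : Maybe Word → Maybe Word → Set where
  none : Related n nothing nothing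
  both : ∀ {z u} → Admissible n z → ψ n z ≡ u → Related n (just z) (just u)

related-step : ∀ {n A p C q} → length A ≡ n → T (transposesTo (summary A) p (summary C) q) →
  Related n (just (plug A p C)) (just (plug A q C))
related-step {A = A} {p} {C} refl h = both (admissible-at refl refl (∧-elimˡ h))
  (trans (ψ-plug A p C) (cong (λ r → plug A r C) (=ᵖ-sound _ _ (∧-elimʳ {admissible (summary A) p (summary C)} h))))

related-map : ∀ {n m m'} → Related n m m' → m' ≡ Maybe.map (ψ n) m
related-map none         = refl
related-map (both _ ψz) = cong just (sym ψz)

related-admissible : ∀ {n m m' z} → Related n m m' → m ≡ just z → Admissible n z
related-admissible (both a _) refl = a

module _ (i : Idx) (A : Word) (p : Letter × Letter) (C : Word) where
  private
    sA sC : Summary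
    sA = summary A
    sC = summary C
    q : Letter × Letter
    q = transposed sA p sC
    n = length A

  ë-related : T (ë-compatibleAt i (hasY i sC) sA p sC) →
    Related n (replaceRight (eL i) (plug A p C)) (replaceRight (eL i) (plug A q C))
  ë-related h = subst₂ (Related n) (sym (replaceRight-plug (eL i) A p C)) (sym (replaceRight-plug (eL i) A q C))
    (byPosition (replaceRight (eL i) C) refl)
    where
    inA : ∀ r → replaceRight (eL i) A ≡ r → T (∀replacement (eL i) sA λ t → transposesTo t p sC q) →
      Related n (Maybe.map (λ A' → plug A' p C) r) (Maybe.map (λ A' → plug A' q C) r)
    inA (just A') e k = related-step {n} {A'} {p} {C} {q} (replacesOne-length (eL i) change)
        (∀replacement-sound (eL i) (λ t → transposesTo t p sC q) change k)
      where change = replaceRight-replacesOne (eL i) {A} {A'} e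
    inA nothing _ _ = none
    inPair : ∀ r r' → T (matchPairs sA sC r r' (∀replacement (eL i) sA λ t → transposesTo t p sC q)) →
      Related n (maybe′ (λ p' → just (plug A p' C)) (Maybe.map (λ A' → plug A' p C) (replaceRight (eL i) A)) r)
                (maybe′ (λ p' → just (plug A p' C)) (Maybe.map (λ A' → plug A' q C) (replaceRight (eL i) A)) r')
    inPair (just r) (just r') k = related-step {n} {A} {r} {C} {r'} refl k
    inPair nothing  nothing   k = inA (replaceRight (eL i) A) refl k
    byPosition : ∀ r → replaceRight (eL i) C ≡ r → Related n
      (maybe′ (λ C' → just (plug A p C')) (maybe′ (λ p' → just (plug A p' C))
         (Maybe.map (λ A' → plug A' p C) (replaceRight (eL i) A)) (replacePairRight (eL i) p)) r)
      (maybe′ (λ C' → just (plug A q C')) (maybe′ (λ p' → just (plug A p' C))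
         (Maybe.map (λ A' → plug A' q C) (replaceRight (eL i) A)) (replacePairRight (eL i) q)) r)
    byPosition (just C') e = related-step {n} {A} {p} {C'} {q} refl
      (∀replacement-sound (eL i) (λ t → transposesTo sA p t q) (replaceRight-replacesOne (eL i) {C} {C'} e)
        (subst (λ b → T (ë-compatibleAt i b sA p sC)) (trans (hasY-replaceRight i C) (cong is-just e)) h))
    byPosition nothing e = inPair (replacePairRight (eL i) p) (replacePairRight (eL i) q)
      (subst (λ b → T (ë-compatibleAt i b sA p sC)) (trans (hasY-replaceRight i C) (cong is-just e)) h)

  f̈-related : T (f̈-compatibleAt i (hasX i sA) sA p sC) →
    Related n (replaceLeft (fL i) (plug A p C)) (replaceLeft (fL i) (plug A q C))
  f̈-related h = subst₂ (Related n) (sym (replaceLeft-plug (fL i) A p C)) (sym (replaceLeft-plug (fL i) A q C))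
    (byPosition (replaceLeft (fL i) A) refl)
    where
    inC : ∀ r → replaceLeft (fL i) C ≡ r → T (∀replacement (fL i) sC λ t → transposesTo sA p t q) →
      Related n (Maybe.map (plug A p) r) (Maybe.map (plug A q) r)
    inC (just C') e k = related-step {n} {A} {p} {C'} {q} refl
      (∀replacement-sound (fL i) (λ t → transposesTo sA p t q) (replaceLeft-replacesOne (fL i) {C} {C'} e) k)
    inC nothing _ _ = none
    inPair : ∀ r r' → T (matchPairs sA sC r r' (∀replacement (fL i) sC λ t → transposesTo sA p t q)) →
      Related n (maybe′ (λ p' → just (plug A p' C)) (Maybe.map (plug A p) (replaceLeft (fL i) C)) r)
                (maybe′ (λ p' → just (plug A p' C)) (Maybe.map (plug A q) (replaceLeft (fL i) C)) r')
    inPair (just r) (just r') k = related-step {n} {A} {r} {C} {r'} refl k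
    inPair nothing  nothing   k = inC (replaceLeft (fL i) C) refl k
    byPosition : ∀ r → replaceLeft (fL i) A ≡ r → Related n
      (maybe′ (λ A' → just (plug A' p C)) (maybe′ (λ p' → just (plug A p' C))
         (Maybe.map (plug A p) (replaceLeft (fL i) C)) (replacePairLeft (fL i) p)) r)
      (maybe′ (λ A' → just (plug A' q C)) (maybe′ (λ p' → just (plug A p' C))
         (Maybe.map (plug A q) (replaceLeft (fL i) C)) (replacePairLeft (fL i) q)) r)
    byPosition (just A') e = related-step {n} {A'} {p} {C} {q} (replacesOne-length (fL i) change)
      (∀replacement-sound (fL i) (λ t → transposesTo t p sC q) change
        (subst (λ b → T (f̈-compatibleAt i b sA p sC)) (trans (hasX-replaceLeft i A) (cong is-just e)) h))
      where change = replaceLeft-replacesOne (fL i) {A} {A'} e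
    byPosition nothing e = inPair (replacePairLeft (fL i) p) (replacePairLeft (fL i) q)
      (subst (λ b → T (f̈-compatibleAt i b sA p sC)) (trans (hasX-replaceLeft i A) (cong is-just e)) h)

if-else-cong : ∀ {X : Set} {b b'} {x u v : X} → b' ≡ b → (b ≡ false → u ≡ v) →
  (if b' then x else u) ≡ (if b then x else v)
if-else-cong {b = true}  refl _ = refl
if-else-cong {b = false} refl k = k refl

if-else-related : ∀ {n b b'} {u v : Maybe Word} → b' ≡ b → (b ≡ false → Related n u v) →
  Related n (if b then nothing else u) (if b' then nothing else v)
if-else-related {b = true}  refl _ = none
if-else-related {b = false} refl k = k refl

module Configuration (A : Word) (p : Letter × Letter) (C : Word) (adm : T (admissible (summary A) p (summary C))) where
  private
    sA sC : Summary
    sA = summary A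
    sC = summary C
    q : Letter × Letter
    q = transposed sA p sC
    n = length A

  compatible-here : ∀ i → T (compatible i sA p sC)
  compatible-here i = ⇒-elim {admissible sA p sC}
    (∀ᶜ-elim (λ sA p sC → admissible sA p sC ⇒ compatible i sA p sC) (admissible-compatible i) A p C) adm

  inv-transposed : ∀ i → inv i (around sA q sC) ≡ inv i (around sA p sC)
  inv-transposed i = ⇔-sound _ _ (∧-elimˡ (compatible-here i))

  hasInv-transposed : ∀ i → hasInv i (plug A q C) ≡ hasInv i (plug A p C)
  hasInv-transposed i = begin
    hasInv i (plug A q C)         ≡⟨ hasInv-plug i A q C ⟩
    inv i (around sA q sC)        ≡⟨ inv-transposed i ⟩
    inv i (around sA p sC)        ≡⟨ hasInv-plug i A p C ⟨
    hasInv i (plug A p C)         ∎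
    where open ≡-Reasoning

  without-inversion : ∀ i → hasInv i (plug A p C) ≡ false →
    T (sameCounts i p q ∧ ë-compatibleAt i (hasY i sC) sA p sC ∧ f̈-compatibleAt i (hasX i sA) sA p sC)
  without-inversion i e = ⇒-elim {not (inv i (around sA p sC))}
    (∧-elimʳ {inv i (around sA q sC) ⇔ inv i (around sA p sC)} (compatible-here i))
    (subst (T ∘ not) (trans (sym e) (hasInv-plug i A p C)) _)

  ë-transposed : ∀ i → Related n (ë i (plug A p C)) (ë i (plug A q C))
  ë-transposed i = if-else-related (hasInv-transposed i)
    (λ e → ë-related i A p C (∧-elimˡ (∧-elimʳ {sameCounts i p q} (without-inversion i e))))

  f̈-transposed : ∀ i → Related n (f̈ i (plug A p C)) (f̈ i (plug A q C))
  f̈-transposed i = if-else-related (hasInv-transposed i)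
    (λ e → f̈-related i A p C (∧-elimʳ {ë-compatibleAt i (hasY i sC) sA p sC}
                                (∧-elimʳ {sameCounts i p q} (without-inversion i e))))

  ε-transposed : ∀ i → ε̈ i (plug A q C) ≡ ε̈ i (plug A p C)
  ε-transposed i = trans (ε̈-yCount i (plug A q C)) (trans (if-else-cong (hasInv-transposed i) λ e →
      cong fin (plug-homomorphic _+_ (yCount i) (yCount-++ i) A C
        (≡ᵇ⇒≡ _ _ (∧-elimʳ {xCount i (pairWord q) ≡ᵇ xCount i (pairWord p)} (∧-elimˡ (without-inversion i e))))))
    (sym (ε̈-yCount i (plug A p C))))

  φ-transposed : ∀ i → φ̈ i (plug A q C) ≡ φ̈ i (plug A p C)
  φ-transposed i = trans (φ̈-xCount i (plug A q C)) (trans (if-else-cong (hasInv-transposed i) λ e →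
      cong fin (plug-homomorphic _+_ (xCount i) (xCount-++ i) A C
        (≡ᵇ⇒≡ _ _ (∧-elimˡ (∧-elimˡ (without-inversion i e))))))
    (sym (φ̈-xCount i (plug A p C))))

  wt-transposed : wt (plug A q C) ≡ wt (plug A p C)
  wt-transposed = plug-homomorphic _+ʷ_ wt wt-++ A C (wt-transpose (inv₁ (around sA p sC)) p)

transposed-injective : ∀ A {p p'} C → T (admissible (summary A) p (summary C)) → T (admissible (summary A) p' (summary C)) →
  transposed (summary A) p (summary C) ≡ transposed (summary A) p' (summary C) → p ≡ p'
transposed-injective A {p} {p'} C adm adm' e = begin
  p                   ≡⟨ transpose-involutive b p ⟨
  transpose b (transpose b p)     ≡⟨ cong (transpose b) e ⟩
  transpose b (transpose b' p')   ≡⟨ cong (λ c → transpose c (transpose b' p')) b≡b' ⟩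
  transpose b' (transpose b' p')  ≡⟨ transpose-involutive b' p' ⟩
  p'                  ∎
  where
  open ≡-Reasoning
  b b' : Bool
  b  = inv₁ (around (summary A) p (summary C))
  b' = inv₁ (around (summary A) p' (summary C))
  b≡b' : b ≡ b'
  b≡b' = trans (sym (Configuration.inv-transposed A p C adm i1))
           (trans (cong (λ r → inv₁ (around (summary A) r (summary C))) e) (Configuration.inv-transposed A p' C adm' i1))

module _ {n : ℕ} where
  admissible-ψ : ∀ {z} → (a : Admissible n z) → let open Admissible a in
    ψ n z ≡ plug A (transposed (summary A) pair (summary C)) C
  admissible-ψ (admissible-at {A} {C} {p} refl refl _) = ψ-plug A p C

  ψ-injective : ∀ {z z'} → Admissible n z → Admissible n z' → ψ n z ≡ ψ n z' → z ≡ z'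
  ψ-injective a@(admissible-at {A} {C} {p} refl refl adm) a'@(admissible-at {A'} {C'} {p'} refl len adm') e
    with refl , e₁ , refl ← plug-injective A A' C C' (sym len) (trans (sym (admissible-ψ a)) (trans e (admissible-ψ a')))
    = cong (λ r → plug A r C) (transposed-injective A C adm adm' e₁)

  admissible-ë : ∀ {z z'} i → Admissible n z → ë i z ≡ just z' → Admissible n z'
  admissible-ë i (admissible-at {A} {C} {p} refl refl adm) = related-admissible (Configuration.ë-transposed A p C adm i)

  admissible-f̈ : ∀ {z z'} i → Admissible n z → f̈ i z ≡ just z' → Admissible n z'
  admissible-f̈ i (admissible-at {A} {C} {p} refl refl adm) = related-admissible (Configuration.f̈-transposed A p C adm i)

  ψ-ë : ∀ {z} i → Admissible n z → ë i (ψ n z) ≡ Maybe.map (ψ n) (ë i z)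
  ψ-ë i a@(admissible-at {A} {C} {p} refl refl adm) =
    trans (cong (ë i) (admissible-ψ a)) (related-map (Configuration.ë-transposed A p C adm i))

  ψ-f̈ : ∀ {z} i → Admissible n z → f̈ i (ψ n z) ≡ Maybe.map (ψ n) (f̈ i z)
  ψ-f̈ i a@(admissible-at {A} {C} {p} refl refl adm) =
    trans (cong (f̈ i) (admissible-ψ a)) (related-map (Configuration.f̈-transposed A p C adm i))

  ψ-wt : ∀ {z} → Admissible n z → wt (ψ n z) ≡ wt z
  ψ-wt a@(admissible-at {A} {C} {p} refl refl adm) = trans (cong wt (admissible-ψ a)) (Configuration.wt-transposed A p C adm)

  ψ-ε : ∀ {z} i → Admissible n z → ε̈ i (ψ n z) ≡ ε̈ i z
  ψ-ε i a@(admissible-at {A} {C} {p} refl refl adm) = trans (cong (ε̈ i) (admissible-ψ a)) (Configuration.ε-transposed A p C adm i)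

  ψ-φ : ∀ {z} i → Admissible n z → φ̈ i (ψ n z) ≡ φ̈ i z
  ψ-φ i a@(admissible-at {A} {C} {p} refl refl adm) = trans (cong (φ̈ i) (admissible-ψ a)) (Configuration.φ-transposed A p C adm i)

admissible-simulation : ∀ A p C → T (admissible (summary A) p (summary C)) → Simulation (plug A p C)
admissible-simulation A p C adm = record
  { Inv = Admissible (length A) ; ψ = ψ (length A) ; base = admissible-at refl refl adm
  ; inv-ë = admissible-ë ; inv-f̈ = admissible-f̈ ; ψ-injective = ψ-injective
  ; ψ-wt = ψ-wt ; ψ-ε = ψ-ε ; ψ-φ = ψ-φ ; ψ-ë = ψ-ë ; ψ-f̈ = ψ-f̈ }

transpositionCondition : Summary → Letter × Letter → Summary → Bool
transpositionCondition sA (x , y) sC =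
  occurs x sA ∧ occurs y sA ∧ occurs x sC ∧ occurs y sC ⇒ (x == y) ∨ transposesTo sA (x , y) sC (y , x)

transposition-admissible : T (∀ᶜ transpositionCondition)
transposition-admissible = _

transposition : ∀ A {x y} C → x ∈ A → y ∈ A → x ∈ C → y ∈ C → (A ++ x ∷ y ∷ C) ∼̈ (A ++ y ∷ x ∷ C)
transposition A {x} {y} C xA yA xC yC with x ≟ˡ y
... | yes refl = ∼̈-refl _
... | no x≢y = subst ((A ++ x ∷ y ∷ C) ∼̈_) ψ≡
    (Simulation.isomorphism (admissible-simulation A (x , y) C (∧-elimˡ settled)))
  where
  sA sC : Summary
  sA = summary A
  sC = summary C
  settled : T (transposesTo sA (x , y) sC (y , x))
  settled = ∨-resolve {x == y}
    (⇒-elim {occurs x sA ∧ occurs y sA ∧ occurs x sC ∧ occurs y sC}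
      (∀ᶜ-elim transpositionCondition transposition-admissible A (x , y) C)
      (∧-intro (∈⇒occurs xA) (∧-intro (∈⇒occurs yA) (∧-intro (∈⇒occurs xC) (∈⇒occurs yC)))))
    (x≢y ∘ ==-sound x y)
  ψ≡ : ψ (length A) (A ++ x ∷ y ∷ C) ≡ A ++ y ∷ x ∷ C
  ψ≡ = trans (ψ-plug A (x , y) C)
         (cong (λ r → plug A r C) (=ᵖ-sound _ _ (∧-elimʳ {admissible sA (x , y) sC} settled)))

-- Commuting factors

++-∷ : ∀ (A : Word) a B → (A ++ a ∷ []) ++ B ≡ A ++ a ∷ B
++-∷ A a B = ++-assoc A (a ∷ []) B

commute-letter : ∀ u {A C y} → u ⊆ A → u ⊆ C → y ∈ A → y ∈ C → (A ++ u ++ y ∷ C) ∼̈ (A ++ y ∷ u ++ C)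
commute-letter []      _   _   _  _  = ∼̈-refl _
commute-letter (x ∷ u) {A} {C} {y} uA uC yA yC = ∼̈-trans
  (subst₂ _∼̈_ (++-∷ A x (u ++ y ∷ C)) (++-∷ A x (y ∷ u ++ C))
    (commute-letter u (xs⊆xs++ys A _ ∘ uA ∘ there) (uC ∘ there) (xs⊆xs++ys A _ yA) yC))
  (transposition A (u ++ C) (uA (here refl)) yA (xs⊆ys++xs C u (uC (here refl))) (xs⊆ys++xs C u yC))

commute : ∀ v {A C u} → u ⊆ A → u ⊆ C → v ⊆ A → v ⊆ C → (A ++ u ++ v ++ C) ∼̈ (A ++ v ++ u ++ C)
commute []      _ _ _ _ = ∼̈-refl _
commute (y ∷ v) {A} {C} {u} uA uC vA vC = ∼̈-trans
  (commute-letter u uA (xs⊆ys++xs C v ∘ uC) (vA (here refl)) (xs⊆ys++xs C v (vC (here refl))))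
  (subst₂ _∼̈_ (++-∷ A y (u ++ v ++ C)) (++-∷ A y (v ++ u ++ C))
    (commute v (xs⊆xs++ys A _ ∘ uA) uC (xs⊆xs++ys A _ ∘ vA ∘ there) (vC ∘ there)))

theorem9p32 : (u v : Word) →
    (u ++ v ++ u ++ v ++ u ++ v) ∼̈ (u ++ v ++ v ++ u ++ u ++ v)
theorem9p32 u v = subst₂ _∼̈_ (++-assoc u v (u ++ v ++ u ++ v)) (++-assoc u v (v ++ u ++ u ++ v))
  (commute v (xs⊆xs++ys u v) (xs⊆xs++ys u v) (xs⊆ys++xs v u) (xs⊆ys++xs v u))
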